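{- Let $n\geq 3$ be an integer and consider the graph $K_n\odot W_{n+1}$ with vertex set $\{u_i, v_{i,j}: 1\leq i\leq n,\ 0\leq j\leq n+1\}$, where $u_1,\dots,u_n$ are the vertices of $K_n$ (pairwise adjacent), and for each $i$: $v_{i,0}$ is adjacent to all $v_{i,j}$, $1\leq j\leq n+1$; $v_{i,j}v_{i,j+1}$ ($1\leq j\leq n$) and $v_{i,1}v_{i,n+1}$ are edges; and $u_i$ is adjacent to every $v_{i,j}$, $0\leq j\leq n+1$. Let $\Pi$ be a resolving partition of this graph. Then: (1) for $i\neq k$ in $\{1,\dots,n\}$, the vertices $v_{i,0}$ and $v_{k,0}$ are same level vertices; (2) for all $j,m\in\{1,\dots,n+1\}$ and $i,k\in\{1,\dots,n\}$, the vertices $v_{i,j}$ and $v_{k,m}$ are same level vertices; (3) for $i\neq j$ in $\{1,\dots,n\}$, the vertices $u_i$ and $u_j$ are same level vertices.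
   Context: $d$ denotes shortest-path distance. For an ordered partition $\Pi=\{S_1,\dots,S_k\}$ of $V(G)$, $r(v\mid\Pi)=(d(v,S_1),\dots,d(v,S_k))$ with $d(v,S)=\min_{x\in S}d(v,x)$; $\Pi$ is resolving if all representations are distinct. Two vertices $u,v$ of a connected graph $G$ are same level vertices if for every positive integer $k$: whenever some $x$ satisfies $d(u,x)=k$, some $y$ satisfies $d(v,y)=k$, and $|\{x\in V(G): d(u,x)=k\}|=|\{y\in V(G): d(v,y)=k\}|$. -}

module Defs where

open import Data.Nat using (ℕ; zero; suc; _+_; _≤_)
open import Data.Fin using (Fin; toℕ)
open import Data.Product using (Σ; _×_; ∃; ∃-syntax)
open import Data.List using (List; length)
open import Data.List.Relation.Unary.Unique.Propositional using (Unique)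
open import Data.List.Membership.Propositional using (_∈_)
open import Function.Bundles using (_⇔_)
open import Relation.Binary.PropositionalEquality using (_≡_; _≢_)

data Walk {V : Set} (E : V → V → Set) : V → V → ℕ → Set where
  nil  : ∀ {x} → Walk E x x 0
  step : ∀ {x y z k} → E x y → Walk E y z k → Walk E x z (suc k)

Dist : {V : Set} (E : V → V → Set) → V → V → ℕ → Set
Dist E x y k = Walk E x y k × (∀ j → Walk E x y j → k ≤ j)

DistSet : {V : Set} (E : V → V → Set) → V → (V → Set) → ℕ → Set
DistSet E x S k =
  (∃[ s ] (S s × Dist E x s k)) × (∀ s j → S s → Dist E x s j → k ≤ j)

-- An ordered partition Π = {S_1,...,S_k} of V, given by the class map
-- cls : V → Fin k (S_c = cls⁻¹(c)); each class is nonempty.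
IsOrderedPartition : {V : Set} (k : ℕ) → (V → Fin k) → Set
IsOrderedPartition {V} k cls = ∀ (c : Fin k) → ∃[ x ] (cls x ≡ c)

Class : {V : Set} {k : ℕ} → (V → Fin k) → Fin k → V → Set
Class cls c x = cls x ≡ c

-- r(x|Π) = r(y|Π): for every class c and every m, d(x,S_c)=m iff d(y,S_c)=m.
SameRep : {V : Set} (E : V → V → Set) {k : ℕ} → (V → Fin k) → V → V → Set
SameRep E {k} cls x y = ∀ (c : Fin k) (m : ℕ) →
  DistSet E x (Class cls c) m ⇔ DistSet E y (Class cls c) m

IsResolvingPartition : {V : Set} (E : V → V → Set) (k : ℕ) → (V → Fin k) → Set
IsResolvingPartition E k cls =
  IsOrderedPartition k cls × (∀ x y → SameRep E cls x y → x ≡ y)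

-- L lists (without repetition) exactly the vertices at distance k from x,
-- so length L = |{y : d(x,y) = k}|.
LevelList : {V : Set} (E : V → V → Set) → V → ℕ → List V → Set
LevelList E x k L = Unique L × (∀ y → (y ∈ L) ⇔ Dist E x y k)

SameLevel : {V : Set} (E : V → V → Set) → V → V → Set
SameLevel E u v = ∀ (k : ℕ) → 1 ≤ k →
  ((∃[ x ] Dist E u x k) → (∃[ y ] Dist E v y k)) ×
  (∀ L M → LevelList E u k L → LevelList E v k M → length L ≡ length M)

-- The graph K_n ⊙ W_{n+1}.
-- u i  = u_{i+1}, and  v i j = v_{i+1,j} (j = 0,...,n+1), Fin indices 0-based for i.

data Vtx (n : ℕ) : Set where
  u : Fin n → Vtx n
  v : Fin n → Fin (2 + n) → Vtx n

data Adj (n : ℕ) : Vtx n → Vtx n → Set where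
  uu    : ∀ {i k} → i ≢ k → Adj n (u i) (u k)
  uv    : ∀ {i j} → Adj n (u i) (v i j)
  vu    : ∀ {i j} → Adj n (v i j) (u i)
  hub   : ∀ {i j0 j} → toℕ j0 ≡ 0 → 1 ≤ toℕ j → Adj n (v i j0) (v i j)
  hub'  : ∀ {i j0 j} → toℕ j0 ≡ 0 → 1 ≤ toℕ j → Adj n (v i j) (v i j0)
  rim   : ∀ {i j j'} → 1 ≤ toℕ j → toℕ j' ≡ suc (toℕ j) → Adj n (v i j) (v i j')
  rim'  : ∀ {i j j'} → 1 ≤ toℕ j → toℕ j' ≡ suc (toℕ j) → Adj n (v i j') (v i j)
  wrap  : ∀ {i j j'} → toℕ j ≡ 1 → toℕ j' ≡ suc n → Adj n (v i j) (v i j')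
  wrap' : ∀ {i j j'} → toℕ j ≡ 1 → toℕ j' ≡ suc n → Adj n (v i j') (v i j)

-- An automorphism preserves distances, hence the number of vertices at each
-- distance, so two vertices in the same orbit of the automorphism group of
-- K_n ⊙ W_{n+1} are same level vertices.  Permuting the n copies of the wheel
-- moves u_i to u_l and v_{i,j} to v_{l,j}; a reflection of one rim, fixing
-- everything else, is an automorphism, and the composite of the reflections
-- a ↦ n+2−a and a ↦ n+3−a of the rim {1,…,n+1} rotates it by one step.
module Submission where

open import Defs
open import Data.Nat using (ℕ; zero; suc; _+_; _∸_; _≤_; z≤n; s≤s; s≤s⁻¹)
open import Data.Nat.Properties using (n∸n≡0; m∸[m∸n]≡n; m∸n≤m; +-∸-assoc; ≤-refl; ≤-trans; n≤1+n)
open import Data.Fin using (Fin; toℕ; fromℕ<; zero)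
open import Data.Fin.Patterns using (1F)
open import Data.Fin.Properties using (toℕ-injective; toℕ-fromℕ<; toℕ<n; _≟_)
open import Data.Fin.Permutation using (Permutation′; _⟨$⟩ʳ_; _⟨$⟩ˡ_; inverseˡ; inverseʳ; flip; transpose)
open import Data.Product using (_×_; _,_; Σ)
open import Data.List using (length; map)
open import Data.List.Properties using (length-map)
open import Data.List.Membership.Propositional using (_∈_)
open import Data.List.Membership.Propositional.Properties using (∈-map⁺; ∈-map⁻)
open import Data.List.Membership.Propositional.Properties.WithK using (unique∧set⇒bag)
open import Data.List.Relation.Unary.Unique.Propositional.Properties using (map⁺)
open import Data.List.Relation.Binary.BagAndSetEquality using (∼bag⇒↭)
open import Data.List.Relation.Binary.Permutation.Propositional.Properties using (↭-length)
open import Function.Bundles using (mk⇔; Equivalence; Injection)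
open import Function.Construct.Composition using (_⇔-∘_)
open import Function.Construct.Symmetry using (⇔-sym)
open import Function.Properties.Inverse using (↔⇒↣)
open import Relation.Nullary.Decidable using (dec-true)
open import Relation.Binary.PropositionalEquality

record Automorphism {V : Set} (E : V → V → Set) : Set where
  field
    to from  : V → V
    to-adj   : ∀ {x y} → E x y → E (to x) (to y)
    from-adj : ∀ {x y} → E x y → E (from x) (from y)
    from-to  : ∀ x → from (to x) ≡ x
    to-from  : ∀ x → to (from x) ≡ x

Similar : {V : Set} (E : V → V → Set) → V → V → Set
Similar E a b = Σ (Automorphism E) λ σ → Automorphism.to σ a ≡ b

module _ {V : Set} {E : V → V → Set} where

  Walk-map : (h : V → V) → (∀ {x y} → E x y → E (h x) (h y)) →
             ∀ {a b k} → Walk E a b k → Walk E (h a) (h b) k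
  Walk-map h h-adj nil        = nil
  Walk-map h h-adj (step e w) = step (h-adj e) (Walk-map h h-adj w)

  Automorphism-id : Automorphism E
  Automorphism-id = record
    { to = λ x → x ; from = λ x → x ; to-adj = λ e → e ; from-adj = λ e → e
    ; from-to = λ _ → refl ; to-from = λ _ → refl }

  Automorphism-inverse : Automorphism E → Automorphism E
  Automorphism-inverse σ = record
    { to = from ; from = to ; to-adj = from-adj ; from-adj = to-adj
    ; from-to = to-from ; to-from = from-to }
    where open Automorphism σ

  Automorphism-∘ : Automorphism E → Automorphism E → Automorphism E
  Automorphism-∘ τ σ = record
    { to       = λ x → τ.to (σ.to x)
    ; from     = λ x → σ.from (τ.from x)
    ; to-adj   = λ e → τ.to-adj (σ.to-adj e)
    ; from-adj = λ e → σ.from-adj (τ.from-adj e)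
    ; from-to  = λ x → trans (cong σ.from (τ.from-to (σ.to x))) (σ.from-to x)
    ; to-from  = λ x → trans (cong τ.to (σ.to-from (τ.from x))) (τ.to-from x) }
    where module σ = Automorphism σ
          module τ = Automorphism τ

  Dist-to : (σ : Automorphism E) → ∀ {a x k} → Dist E a x k →
            Dist E (Automorphism.to σ a) (Automorphism.to σ x) k
  Dist-to σ {a} {x} (w , shortest) = Walk-map to to-adj w , λ j w′ →
    shortest j (subst₂ (λ p q → Walk E p q j) (from-to a) (from-to x) (Walk-map from from-adj w′))
    where open Automorphism σ

  module _ (σ : Automorphism E) where
    open Automorphism σ

    to-injective : ∀ {x y} → to x ≡ to y → x ≡ y
    to-injective {x} {y} eq = trans (sym (from-to x)) (trans (cong from eq) (from-to y))

    Dist-from : ∀ {a x k} → Dist E (to a) x k → Dist E a (from x) k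
    Dist-from {a} d = subst (λ p → Dist E p _ _) (from-to a) (Dist-to (Automorphism-inverse σ) d)

    LevelList-map : ∀ {a k L} → LevelList E a k L → LevelList E (to a) k (map to L)
    LevelList-map {a} {k} {L} (unique , members) = map⁺ to-injective unique , λ y → mk⇔
      (λ y∈ → let (x , x∈ , y≡) = ∈-map⁻ to y∈ in
        subst (λ z → Dist E (to a) z k) (sym y≡) (Dist-to σ (Equivalence.to (members x) x∈)))
      (λ d → subst (_∈ map to L) (to-from y)
        (∈-map⁺ to (Equivalence.from (members (from y)) (Dist-from d))))

  LevelList-length : ∀ {a k L M} → LevelList E a k L → LevelList E a k M → length L ≡ length M
  LevelList-length (uniqueL , membersL) (uniqueM , membersM) =
    ↭-length (∼bag⇒↭ (unique∧set⇒bag uniqueL uniqueM (λ {y} → ⇔-sym (membersM y) ⇔-∘ membersL y)))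

  Similar-refl : ∀ {a} → Similar E a a
  Similar-refl = Automorphism-id , refl

  Similar-sym : ∀ {a b} → Similar E a b → Similar E b a
  Similar-sym {a} (σ , refl) = Automorphism-inverse σ , Automorphism.from-to σ a

  Similar-trans : ∀ {a b c} → Similar E a b → Similar E b c → Similar E a c
  Similar-trans (σ , refl) (τ , refl) = Automorphism-∘ τ σ , refl

  Similar⇒SameLevel : ∀ {a b} → Similar E a b → SameLevel E a b
  Similar⇒SameLevel {a} (σ , refl) k _ =
    (λ (x , d) → to x , Dist-to σ d) ,
    λ L M levelL levelM → trans (sym (length-map to L)) (LevelList-length (LevelList-map σ levelL) levelM)
    where open Automorphism σ

module _ {n : ℕ} where

  relabelCopies : (Fin n → Fin n) → Vtx n → Vtx n
  relabelCopies f (u i)   = u (f i)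
  relabelCopies f (v i j) = v (f i) j

  relabelCopies-adj : ∀ {f} → (∀ {i k} → f i ≡ f k → i ≡ k) →
                      ∀ {x y} → Adj n x y → Adj n (relabelCopies f x) (relabelCopies f y)
  relabelCopies-adj f-inj (uu i≢k)    = uu (λ eq → i≢k (f-inj eq))
  relabelCopies-adj f-inj uv          = uv
  relabelCopies-adj f-inj vu          = vu
  relabelCopies-adj f-inj (hub p q)   = hub p q
  relabelCopies-adj f-inj (hub' p q)  = hub' p q
  relabelCopies-adj f-inj (rim p q)   = rim p q
  relabelCopies-adj f-inj (rim' p q)  = rim' p q
  relabelCopies-adj f-inj (wrap p q)  = wrap p q
  relabelCopies-adj f-inj (wrap' p q) = wrap' p q

  relabelCopies-inverse : ∀ {f g} → (∀ i → g (f i) ≡ i) →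
                          ∀ x → relabelCopies g (relabelCopies f x) ≡ x
  relabelCopies-inverse gf (u i)   = cong u (gf i)
  relabelCopies-inverse gf (v i j) = cong (λ k → v k j) (gf i)

  permuteCopies : Permutation′ n → Automorphism (Adj n)
  permuteCopies π = record
    { to       = relabelCopies (π ⟨$⟩ʳ_)
    ; from     = relabelCopies (π ⟨$⟩ˡ_)
    ; to-adj   = relabelCopies-adj (Injection.injective (↔⇒↣ π))
    ; from-adj = relabelCopies-adj (Injection.injective (↔⇒↣ (flip π)))
    ; from-to  = relabelCopies-inverse (λ _ → inverseˡ π)
    ; to-from  = relabelCopies-inverse (λ _ → inverseʳ π) }

  transpose-matchˡ : (i l : Fin n) → transpose i l ⟨$⟩ʳ i ≡ l
  transpose-matchˡ i l rewrite dec-true (i ≟ i) refl = refl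

  u-similar : (i l : Fin n) → Similar (Adj n) (u i) (u l)
  u-similar i l = permuteCopies (transpose i l) , cong u (transpose-matchˡ i l)

  v-similar : (i l : Fin n) (j : Fin (2 + n)) → Similar (Adj n) (v i j) (v l j)
  v-similar i l j = permuteCopies (transpose i l) , cong (λ k → v k j) (transpose-matchˡ i l)

data WheelAdj (n : ℕ) : ℕ → ℕ → Set where
  spoke  : ∀ {a} → WheelAdj n 0 (suc a)
  spoke' : ∀ {a} → WheelAdj n (suc a) 0
  rim    : ∀ {a} → 1 ≤ a → WheelAdj n a (suc a)
  rim'   : ∀ {a} → 1 ≤ a → WheelAdj n (suc a) a
  wrap   : WheelAdj n 1 (suc n)
  wrap'  : WheelAdj n (suc n) 1

module _ {n : ℕ} where

  toℕ≤1+n : (j : Fin (2 + n)) → toℕ j ≤ suc n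
  toℕ≤1+n j = s≤s⁻¹ (toℕ<n j)

  Adj⇒WheelAdj : ∀ {i i′ j j′} → Adj n (v i j) (v i′ j′) → WheelAdj n (toℕ j) (toℕ j′)
  Adj⇒WheelAdj (hub j₀≡0 1≤j) rewrite j₀≡0 = spoke-from 1≤j
    where spoke-from : ∀ {b} → 1 ≤ b → WheelAdj n 0 b
          spoke-from (s≤s _) = spoke
  Adj⇒WheelAdj (hub' j₀≡0 1≤j) rewrite j₀≡0 = spoke-to 1≤j
    where spoke-to : ∀ {a} → 1 ≤ a → WheelAdj n a 0
          spoke-to (s≤s _) = spoke'
  Adj⇒WheelAdj (rim 1≤j eq) rewrite eq = rim 1≤j
  Adj⇒WheelAdj (rim' 1≤j eq) rewrite eq = rim' 1≤j
  Adj⇒WheelAdj (wrap eq eq′) rewrite eq | eq′ = wrap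
  Adj⇒WheelAdj (wrap' eq eq′) rewrite eq | eq′ = wrap'

  WheelAdj⇒Adj : ∀ {i j j′ a b} → WheelAdj n a b → a ≡ toℕ j → b ≡ toℕ j′ → Adj n (v i j) (v i j′)
  WheelAdj⇒Adj spoke      a≡ b≡ = hub (sym a≡) (subst (1 ≤_) b≡ (s≤s z≤n))
  WheelAdj⇒Adj spoke'     a≡ b≡ = hub' (sym b≡) (subst (1 ≤_) a≡ (s≤s z≤n))
  WheelAdj⇒Adj (rim 1≤a)  a≡ b≡ = rim (subst (1 ≤_) a≡ 1≤a) (trans (sym b≡) (cong suc a≡))
  WheelAdj⇒Adj (rim' 1≤b) a≡ b≡ = rim' (subst (1 ≤_) b≡ 1≤b) (trans (sym a≡) (cong suc b≡))
  WheelAdj⇒Adj wrap       a≡ b≡ = wrap (sym a≡) (sym b≡)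
  WheelAdj⇒Adj wrap'      a≡ b≡ = wrap' (sym b≡) (sym a≡)

record WheelInvolution (n : ℕ) : Set where
  field
    apply      : ℕ → ℕ
    bounded    : ∀ {a} → a ≤ suc n → apply a ≤ suc n
    involutive : ∀ {a} → a ≤ suc n → apply (apply a) ≡ a
    preserves  : ∀ {a b} → a ≤ suc n → b ≤ suc n → WheelAdj n a b → WheelAdj n (apply a) (apply b)

module WheelSymmetry {n : ℕ} (h : WheelInvolution n) where
  open WheelInvolution h

  index : Fin (2 + n) → Fin (2 + n)
  index j = fromℕ< (s≤s (bounded (toℕ≤1+n j)))

  toℕ-index : ∀ j → toℕ (index j) ≡ apply (toℕ j)
  toℕ-index j = toℕ-fromℕ< (s≤s (bounded (toℕ≤1+n j)))

  act : Vtx n → Vtx n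
  act (u i)   = u i
  act (v i j) = v i (index j)

  act-adj-wheel : ∀ {i i′ j j′} → Adj n (v i j) (v i′ j′) → Adj n (v i (index j)) (v i (index j′))
  act-adj-wheel {j = j} {j′} e = WheelAdj⇒Adj (preserves (toℕ≤1+n j) (toℕ≤1+n j′) (Adj⇒WheelAdj e))
    (sym (toℕ-index j)) (sym (toℕ-index j′))

  act-adj : ∀ {x y} → Adj n x y → Adj n (act x) (act y)
  act-adj (uu i≢k)      = uu i≢k
  act-adj uv            = uv
  act-adj vu            = vu
  act-adj e@(hub _ _)   = act-adj-wheel e
  act-adj e@(hub' _ _)  = act-adj-wheel e
  act-adj e@(rim _ _)   = act-adj-wheel e
  act-adj e@(rim' _ _)  = act-adj-wheel e
  act-adj e@(wrap _ _)  = act-adj-wheel e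
  act-adj e@(wrap' _ _) = act-adj-wheel e

  act-involutive : ∀ x → act (act x) ≡ x
  act-involutive (u i)   = refl
  act-involutive (v i j) = cong (v i) (toℕ-injective (begin
    toℕ (index (index j)) ≡⟨ toℕ-index (index j) ⟩
    apply (toℕ (index j)) ≡⟨ cong apply (toℕ-index j) ⟩
    apply (apply (toℕ j)) ≡⟨ involutive (toℕ≤1+n j) ⟩
    toℕ j                 ∎))
    where open ≡-Reasoning

  automorphism : Automorphism (Adj n)
  automorphism = record
    { to = act ; from = act ; to-adj = act-adj ; from-adj = act-adj
    ; from-to = act-involutive ; to-from = act-involutive }

  similar : ∀ i j → Similar (Adj n) (v i j) (v i (index j))
  similar i j = automorphism , refl

reflect : ℕ → ℕ → ℕ
reflect n zero    = zero
reflect n (suc k) = suc (n ∸ k)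

reflect₁ : ℕ → ℕ → ℕ
reflect₁ n zero          = zero
reflect₁ n (suc zero)    = suc zero
reflect₁ n (suc (suc k)) = suc (n ∸ k)

reflect-bounded : ∀ n {a} → a ≤ suc n → reflect n a ≤ suc n
reflect-bounded n {zero}  _ = z≤n
reflect-bounded n {suc k} _ = s≤s (m∸n≤m n k)

reflect-involutive : ∀ n {a} → a ≤ suc n → reflect n (reflect n a) ≡ a
reflect-involutive n {zero}  _         = refl
reflect-involutive n {suc k} (s≤s k≤n) = cong suc (m∸[m∸n]≡n k≤n)

reflect-preserves : ∀ n {a b} → a ≤ suc n → b ≤ suc n → WheelAdj n a b →
                    WheelAdj n (reflect n a) (reflect n b)
reflect-preserves n _ _ spoke  = spoke
reflect-preserves n _ _ spoke' = spoke'
reflect-preserves (suc m) {suc k} _ (s≤s (s≤s k≤m)) (rim _)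
  rewrite +-∸-assoc 1 k≤m = rim' (s≤s z≤n)
reflect-preserves (suc m) {b = suc k} (s≤s (s≤s k≤m)) _ (rim' _)
  rewrite +-∸-assoc 1 k≤m = rim (s≤s z≤n)
reflect-preserves n _ _ wrap  rewrite n∸n≡0 n = wrap'
reflect-preserves n _ _ wrap' rewrite n∸n≡0 n = wrap

reflect₁-bounded : ∀ n {a} → a ≤ suc n → reflect₁ n a ≤ suc n
reflect₁-bounded n {zero}        _   = z≤n
reflect₁-bounded n {suc zero}    1≤n = 1≤n
reflect₁-bounded n {suc (suc k)} _   = s≤s (m∸n≤m n k)

reflect₁-involutive : ∀ n {a} → a ≤ suc n → reflect₁ n (reflect₁ n a) ≡ a
reflect₁-involutive n       {zero}        _ = refl
reflect₁-involutive n       {suc zero}    _ = refl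
reflect₁-involutive (suc m) {suc (suc k)} (s≤s (s≤s k≤m))
  rewrite +-∸-assoc 1 k≤m | +-∸-assoc 1 (m∸n≤m m k) | m∸[m∸n]≡n k≤m = refl

reflect₁-preserves : ∀ n {a b} → a ≤ suc n → b ≤ suc n → WheelAdj n a b →
                     WheelAdj n (reflect₁ n a) (reflect₁ n b)
reflect₁-preserves n _ _ (spoke {zero})    = spoke
reflect₁-preserves n _ _ (spoke {suc _})   = spoke
reflect₁-preserves n _ _ (spoke' {zero})   = spoke'
reflect₁-preserves n _ _ (spoke' {suc _})  = spoke'
reflect₁-preserves n _ _ (rim {suc zero} _)  = wrap
reflect₁-preserves n _ _ (rim' {suc zero} _) = wrap'
reflect₁-preserves (suc m) {suc (suc k)} _ (s≤s (s≤s k<m)) (rim _)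
  rewrite +-∸-assoc 1 (≤-trans (n≤1+n k) k<m) = rim' (s≤s z≤n)
reflect₁-preserves (suc m) {b = suc (suc k)} (s≤s (s≤s k<m)) _ (rim' _)
  rewrite +-∸-assoc 1 (≤-trans (n≤1+n k) k<m) = rim (s≤s z≤n)
reflect₁-preserves zero    _ _ wrap  = wrap
reflect₁-preserves (suc m) _ _ wrap  rewrite +-∸-assoc 1 (≤-refl {m}) | n∸n≡0 m = rim (s≤s z≤n)
reflect₁-preserves zero    _ _ wrap' = wrap'
reflect₁-preserves (suc m) _ _ wrap' rewrite +-∸-assoc 1 (≤-refl {m}) | n∸n≡0 m = rim' (s≤s z≤n)

reflection : (n : ℕ) → WheelInvolution n
reflection n = record
  { apply = reflect n ; bounded = reflect-bounded n
  ; involutive = reflect-involutive n ; preserves = reflect-preserves n }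

reflection₁ : (n : ℕ) → WheelInvolution n
reflection₁ n = record
  { apply = reflect₁ n ; bounded = reflect₁-bounded n
  ; involutive = reflect₁-involutive n ; preserves = reflect₁-preserves n }

reflect₁-reflect : ∀ n k → suc k ≤ n → reflect₁ n (reflect n (suc k)) ≡ suc (suc k)
reflect₁-reflect (suc m) k (s≤s k≤m)
  rewrite +-∸-assoc 1 k≤m | +-∸-assoc 1 (m∸n≤m m k) | m∸[m∸n]≡n k≤m = refl

module _ {n : ℕ} where

  rim-successor-similar : ∀ i k {J J′ : Fin (2 + n)} → suc k ≤ n →
                          toℕ J ≡ suc k → toℕ J′ ≡ suc (suc k) → Similar (Adj n) (v i J) (v i J′)
  rim-successor-similar i k {J} {J′} k<n J≡ J′≡ =
    Similar-trans (R.similar i J)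
      (subst (λ K → Similar (Adj n) (v i (R.index J)) (v i K)) rotation (R₁.similar i (R.index J)))
    where
    module R  = WheelSymmetry (reflection n)
    module R₁ = WheelSymmetry (reflection₁ n)
    open ≡-Reasoning

    rotation : R₁.index (R.index J) ≡ J′
    rotation = toℕ-injective (begin
      toℕ (R₁.index (R.index J))     ≡⟨ R₁.toℕ-index (R.index J) ⟩
      reflect₁ n (toℕ (R.index J))   ≡⟨ cong (reflect₁ n) (R.toℕ-index J) ⟩
      reflect₁ n (reflect n (toℕ J)) ≡⟨ cong (λ a → reflect₁ n (reflect n a)) J≡ ⟩
      reflect₁ n (reflect n (suc k)) ≡⟨ reflect₁-reflect n k k<n ⟩
      suc (suc k)                    ≡⟨ sym J′≡ ⟩
      toℕ J′                         ∎)

  rim-similar-by-position : ∀ i k → k ≤ n → (J : Fin (2 + n)) → toℕ J ≡ suc k → Similar (Adj n) (v i 1F) (v i J)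
  rim-similar-by-position i zero    _   J J≡1 =
    subst (λ K → Similar (Adj n) (v i 1F) (v i K)) (toℕ-injective (sym J≡1)) Similar-refl
  rim-similar-by-position i (suc k) k<n J J≡ =
    Similar-trans (rim-similar-by-position i k k≤n J₀ J₀≡) (rim-successor-similar i k k<n J₀≡ J≡)
    where
    k≤n : k ≤ n
    k≤n = ≤-trans (n≤1+n k) k<n
    J₀ : Fin (2 + n)
    J₀ = fromℕ< (s≤s (s≤s k≤n))
    J₀≡ : toℕ J₀ ≡ suc k
    J₀≡ = toℕ-fromℕ< (s≤s (s≤s k≤n))

  rim-similar : ∀ i (J : Fin (2 + n)) → 1 ≤ toℕ J → Similar (Adj n) (v i 1F) (v i J)
  -- The clause for toℕ J = 0 is omitted: there 1≤J has the empty type 1 ≤ 0.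
  rim-similar i J 1≤J with toℕ J in J≡ | toℕ<n J
  ... | suc k | s≤s (s≤s k≤n) = rim-similar-by-position i k k≤n J J≡

proposition3p2 : (n : ℕ) → 3 ≤ n →
    (k : ℕ) (cls : Vtx n → Fin k) → IsResolvingPartition (Adj n) k cls →
    (∀ (i l : Fin n) → i ≢ l → SameLevel (Adj n) (v i zero) (v l zero)) ×
    (∀ (i l : Fin n) (j m : Fin (2 + n)) → 1 ≤ toℕ j → 1 ≤ toℕ m →
      SameLevel (Adj n) (v i j) (v l m)) ×
    (∀ (i j : Fin n) → i ≢ j → SameLevel (Adj n) (u i) (u j))
proposition3p2 n _ _ _ _ =
  (λ i l _ → Similar⇒SameLevel (v-similar i l zero)) ,
  (λ i l j m 1≤j 1≤m → Similar⇒SameLevel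
    (Similar-trans (Similar-sym (rim-similar i j 1≤j))
      (Similar-trans (v-similar i l 1F) (rim-similar l m 1≤m)))) ,
  (λ i l _ → Similar⇒SameLevel (u-similar i l))
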